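{- Fix $\delta>0$. There is $n(\delta)$ such that for all $n\ge n(\delta)$, among all $n$-vertex graphs with minimum degree at least $\delta$, the unique graph with the most independent sets is $K_{\delta,n-\delta}$.
   Context: All graphs are simple, loopless and finite; an independent set is a vertex subset spanning no edge (the empty set included). $K_{a,b}$ is the complete bipartite graph with parts of sizes $a$ and $b$. -}

module Defs where

open import Data.Nat using (ℕ; zero; suc; _+_; _≤_; _<ᵇ_; _≡ᵇ_)
open import Data.Bool using (Bool; true; false; _∧_; not; _xor_; if_then_else_)
open import Data.Bool.Properties using (xor-same)
open import Data.Fin using (Fin; toℕ)
open import Data.Vec using (Vec; []; _∷_; lookup)
open import Data.List using (List; []; _∷_; map; _++_; length; filterᵇ)
open import Data.Product using (Σ; _×_; _,_)
open import Function.Bundles using (_↔_; Inverse)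
open import Relation.Binary.PropositionalEquality using (_≡_; refl)

record Graph (n : ℕ) : Set where
  field
    adj   : Fin n → Fin n → Bool
    sym   : ∀ u v → adj u v ≡ adj v u
    irrfl : ∀ v → adj v v ≡ false
open Graph public

count : ∀ {n} → (Fin n → Bool) → ℕ
count {zero}  p = 0
count {suc n} p = (if p Fin.zero then 1 else 0) + count (λ i → p (Fin.suc i))

degree : ∀ {n} → Graph n → Fin n → ℕ
degree G v = count (adj G v)

MinDegreeAtLeast : ∀ {n} → ℕ → Graph n → Set
MinDegreeAtLeast δ G = ∀ v → δ ≤ degree G v

-- Vertex subsets as characteristic Boolean vectors; all 2^n of them, each once.
allSubsets : (n : ℕ) → List (Vec Bool n)
allSubsets zero    = [] ∷ []
allSubsets (suc n) = map (false ∷_) (allSubsets n) ++ map (true ∷_) (allSubsets n)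

isIndependent : ∀ {n} → Graph n → Vec Bool n → Bool
isIndependent {n} G S =
  count (λ u → count (λ v → lookup S u ∧ lookup S v ∧ adj G u v) ≡ᵇ 0) ≡ᵇ n

-- i(G): number of independent sets of G (empty set included)
numIndep : ∀ {n} → Graph n → ℕ
numIndep {n} G = length (filterᵇ (isIndependent G) (allSubsets n))

_≅_ : ∀ {n} → Graph n → Graph n → Set
_≅_ {n} G H = Σ (Fin n ↔ Fin n) λ f →
  ∀ u v → adj G u v ≡ adj H (Inverse.to f u) (Inverse.to f v)

-- Complete bipartite graph K_{a,n-a} on Fin n:
-- parts {i | i < a} and {i | a ≤ i}; edges exactly between the parts.
side : ∀ {n} → ℕ → Fin n → Bool
side a i = toℕ i <ᵇ a

xor-comm' : ∀ x y → x xor y ≡ y xor x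
xor-comm' false false = refl
xor-comm' false true  = refl
xor-comm' true  false = refl
xor-comm' true  true  = refl

xor-self : ∀ x → x xor x ≡ false
xor-self false = refl
xor-self true  = refl

K : (n a : ℕ) → Graph n
K n a = record
  { adj   = λ u v → side a u xor side a v
  ; sym   = λ u v → xor-comm' (side a u) (side a v)
  ; irrfl = λ v → xor-self (side a v)
  }

module Submission where

-- Let k = 3δ + 1 and D = 2δ + 3. A greedy matching either reaches k edges or its vertices
-- form a vertex cover W with |W| ≤ 2k. Each edge of a matching excludes a quarter of all
-- vertex sets, so in the first case i(G) ≤ (3/4)^k 2^n < 2^(n-δ) ≤ i(K_{δ,n-δ}).
-- Otherwise let Z be the vertices of W of degree at least D. An independent set meeting Z
-- contains some w ∈ Z and none of its neighbours, so there are at most |Z| 2^(n-D-1) such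
-- sets; the others lie outside Z. If |Z| < δ, every vertex outside W has a neighbour in W∖Z,
-- of degree < D, which bounds n. If |Z| > δ, or |Z| = δ and V∖Z spans an edge, these bounds
-- give again i(G) < 2^(n-δ). In the remaining case V∖Z is independent, so by the degree
-- condition every vertex outside Z is joined to all of Z, and i(G) ≤ 2^(n-δ) + 2^δ - 1 =
-- i(K_{δ,n-δ}) with equality exactly when Z is independent too, i.e. when G ≅ K_{δ,n-δ}.

open import Defs hiding (sym)
open import Data.Nat using (ℕ; zero; suc; _+_; _*_; _^_; _≤_; _<_; z≤n; s≤s; s≤s⁻¹; _≡ᵇ_; _≤ᵇ_)
open import Data.Nat.Properties hiding (_≟_)
open import Data.Bool using (Bool; true; false; _∧_; _∨_; not; if_then_else_; _xor_; T)
open import Data.Bool.Properties using () renaming (_≟_ to _≟ᵇ_)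
open import Data.Bool.Properties
  using (∧-assoc; ∧-zeroʳ; ∨-zeroʳ; ∧-inverseʳ; ∧-conicalˡ; ∧-conicalʳ; ¬-not; not-injective; not-¬; xor-same; T-≡)
open import Data.Fin using (Fin; zero; suc; _≟_)
open import Data.Fin.Properties using (any?; ¬Fin0)
open import Data.Vec using (Vec; []; _∷_; lookup; updateAt; tabulate)
open import Data.Fin.Permutation using (Permutation′; _⟨$⟩ʳ_; transpose; lift₀; _∘ₚ_) renaming (id to idₚ)
open import Algebra.Properties.CommutativeMonoid.Sum +-0-commutativeMonoid using (sum; sum-permute)
open import Data.Vec.Properties using (lookup∘updateAt; lookup∘updateAt′; lookup∘tabulate)
open import Data.List using (List; []; _∷_; map; _++_; length; filterᵇ; allFin)
import Data.List as List
open import Data.Product using (Σ; ∃-syntax; _×_; _,_; proj₁)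
open import Data.Sum using (_⊎_; inj₁; inj₂)
open import Data.Unit using (⊤; tt)
open import Function using (_∘_; id; Equivalence)
open import Data.Nat.Tactic.RingSolver using (solve-∀)
open import Relation.Nullary using (¬_; yes; no; does; contradiction)
open import Relation.Nullary.Decidable using (dec-true)
open import Relation.Binary using (tri<; tri≈; tri>)
open import Relation.Binary.PropositionalEquality
  using (_≡_; _≢_; refl; sym; trans; cong; cong₂; subst; subst₂; module ≡-Reasoning)

⟦_⟧ : Bool → ℕ
⟦ b ⟧ = if b then 1 else 0

_⇒ᵇ_ : {A : Set} → (A → Bool) → (A → Bool) → Set
p ⇒ᵇ q = ∀ x → p x ≡ true → q x ≡ true

∁ : {A : Set} → (A → Bool) → A → Bool
∁ p x = not (p x)

⟦⟧-mono : ∀ {a b} → (a ≡ true → b ≡ true) → ⟦ a ⟧ ≤ ⟦ b ⟧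
⟦⟧-mono {false} _   = z≤n
⟦⟧-mono {true}  a⇒b rewrite a⇒b refl = ≤-refl

countᴸ : {A : Set} → (A → Bool) → List A → ℕ
countᴸ p []       = 0
countᴸ p (x ∷ xs) = ⟦ p x ⟧ + countᴸ p xs

module _ {A : Set} where

  countᴸ-cong : ∀ {p q : A → Bool} → (∀ x → p x ≡ q x) → ∀ xs → countᴸ p xs ≡ countᴸ q xs
  countᴸ-cong p≡q []       = refl
  countᴸ-cong p≡q (x ∷ xs) = cong₂ _+_ (cong ⟦_⟧ (p≡q x)) (countᴸ-cong p≡q xs)

  countᴸ-mono : ∀ {p q : A → Bool} → p ⇒ᵇ q → ∀ xs → countᴸ p xs ≤ countᴸ q xs
  countᴸ-mono p⇒q [] = z≤n
  countᴸ-mono p⇒q (x ∷ xs) = +-mono-≤ (⟦⟧-mono (p⇒q x)) (countᴸ-mono p⇒q xs)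

  countᴸ-false : ∀ {p : A → Bool} → (∀ x → p x ≡ false) → ∀ xs → countᴸ p xs ≡ 0
  countᴸ-false p≡false []       = refl
  countᴸ-false p≡false (x ∷ xs) rewrite p≡false x = countᴸ-false p≡false xs

  countᴸ-split : ∀ (p q : A → Bool) xs →
    countᴸ p xs ≡ countᴸ (λ x → p x ∧ q x) xs + countᴸ (λ x → p x ∧ not (q x)) xs
  countᴸ-split p q [] = refl
  countᴸ-split p q (x ∷ xs) with p x | q x
  ... | false | _     = countᴸ-split p q xs
  ... | true  | true  = cong suc (countᴸ-split p q xs)
  ... | true  | false = trans (cong suc (countᴸ-split p q xs)) (sym (+-suc _ _))

  countᴸ-∨ : ∀ (p q : A → Bool) xs → countᴸ (λ x → p x ∨ q x) xs ≤ countᴸ p xs + countᴸ q xs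
  countᴸ-∨ p q xs = begin
      countᴸ p∨q xs
    ≡⟨ countᴸ-split p∨q p xs ⟩
      countᴸ (λ x → p∨q x ∧ p x) xs + countᴸ (λ x → p∨q x ∧ not (p x)) xs
    ≤⟨ +-mono-≤ (countᴸ-mono (λ x → ∧-conicalʳ (p∨q x) _) xs) (countᴸ-mono (λ x → only-q (p x)) xs) ⟩
      countᴸ p xs + countᴸ q xs
    ∎
    where
    open ≤-Reasoning
    p∨q : A → Bool
    p∨q x = p x ∨ q x
    only-q : ∀ a {b} → (a ∨ b) ∧ not a ≡ true → b ≡ true
    only-q false {true} _ = refl

  countᴸ-++ : ∀ (p : A → Bool) xs ys → countᴸ p (xs ++ ys) ≡ countᴸ p xs + countᴸ p ys
  countᴸ-++ p []       ys = refl
  countᴸ-++ p (x ∷ xs) ys = trans (cong (⟦ p x ⟧ +_) (countᴸ-++ p xs ys)) (sym (+-assoc ⟦ p x ⟧ _ _))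

  countᴸ-map : ∀ {B : Set} (p : A → Bool) (f : B → A) xs → countᴸ p (map f xs) ≡ countᴸ (p ∘ f) xs
  countᴸ-map p f []       = refl
  countᴸ-map p f (x ∷ xs) = cong (⟦ p (f x) ⟧ +_) (countᴸ-map p f xs)

  length-filterᵇ : ∀ (p : A → Bool) xs → length (filterᵇ p xs) ≡ countᴸ p xs
  length-filterᵇ p []       = refl
  length-filterᵇ p (x ∷ xs) with p x
  ... | true  = cong suc (length-filterᵇ p xs)
  ... | false = length-filterᵇ p xs

  union-bound : ∀ {m} (Z : Fin m → Bool) (f : Fin m → A → Bool) {r c} (p : A → Bool) xs →
    (∀ j → Z j ≡ true → countᴸ (f j) xs * r ≤ c) →
    (∀ x → p x ≡ true → ∃[ j ] Z j ≡ true × f j x ≡ true) →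
    countᴸ p xs * r ≤ count Z * c
  union-bound {zero} Z f {r} p xs _ covered =
    ≤-reflexive (cong (_* r) (countᴸ-false (λ x → ¬-not (¬Fin0 ∘ proj₁ ∘ covered x)) xs))
  union-bound {suc m} Z f {r} {c} p xs small covered with Z zero in Z₀
  ... | false = union-bound (Z ∘ suc) (f ∘ suc) p xs (small ∘ suc) covered′
    where
    covered′ : ∀ x → p x ≡ true → ∃[ j ] Z (suc j) ≡ true × f (suc j) x ≡ true
    covered′ x px with covered x px
    ... | zero  , Zj , _ = contradiction (trans (sym Z₀) Zj) λ ()
    ... | suc j , Zj , fj = j , Zj , fj
  ... | true = begin
      countᴸ p xs * r
    ≡⟨ cong (_* r) (countᴸ-split p (f zero) xs) ⟩
      (countᴸ (λ x → p x ∧ f zero x) xs + countᴸ p′ xs) * r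
    ≡⟨ *-distribʳ-+ r (countᴸ (λ x → p x ∧ f zero x) xs) _ ⟩
      countᴸ (λ x → p x ∧ f zero x) xs * r + countᴸ p′ xs * r
    ≤⟨ +-mono-≤ (≤-trans (*-monoˡ-≤ r (countᴸ-mono (λ x → ∧-conicalʳ (p x) _) xs)) (small zero Z₀))
                (union-bound (Z ∘ suc) (f ∘ suc) p′ xs (small ∘ suc) covered′) ⟩
      c + count (Z ∘ suc) * c
    ∎
    where
    open ≤-Reasoning
    p′ : A → Bool
    p′ x = p x ∧ not (f zero x)
    covered′ : ∀ x → p′ x ≡ true → ∃[ j ] Z (suc j) ≡ true × f (suc j) x ≡ true
    covered′ x p′x with covered x (∧-conicalˡ _ _ p′x)
    ... | zero  , _  , f₀x = contradiction (trans (sym (cong not f₀x)) (∧-conicalʳ (p x) _ p′x)) λ ()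
    ... | suc j , Zj , fj  = j , Zj , fj

countᴸ-tabulate : ∀ {A : Set} {n} (p : A → Bool) (f : Fin n → A) → countᴸ p (List.tabulate f) ≡ count (p ∘ f)
countᴸ-tabulate {n = zero}  p f = refl
countᴸ-tabulate {n = suc n} p f = cong (⟦ p (f zero) ⟧ +_) (countᴸ-tabulate p (f ∘ suc))

countᴸ-allFin : ∀ {n} (p : Fin n → Bool) → countᴸ p (allFin n) ≡ count p
countᴸ-allFin p = countᴸ-tabulate p id

module _ {n : ℕ} where

  count-mono : ∀ {p q : Fin n → Bool} → p ⇒ᵇ q → count p ≤ count q
  count-mono {p} {q} p⇒q = subst₂ _≤_ (countᴸ-allFin p) (countᴸ-allFin q) (countᴸ-mono p⇒q (allFin n))

  count-∨ : ∀ (p q : Fin n → Bool) → count (λ i → p i ∨ q i) ≤ count p + count q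
  count-∨ p q = subst₂ _≤_ (countᴸ-allFin (λ i → p i ∨ q i)) (cong₂ _+_ (countᴸ-allFin p) (countᴸ-allFin q))
    (countᴸ-∨ p q (allFin n))

  ≡false⇒count≡0 : ∀ {p : Fin n → Bool} → (∀ i → p i ≡ false) → count p ≡ 0
  ≡false⇒count≡0 {p} p≡false = trans (sym (countᴸ-allFin p)) (countᴸ-false p≡false (allFin n))

count-complement : ∀ {n} (p : Fin n → Bool) → count p + count (∁ p) ≡ n
count-complement {zero}  p = refl
count-complement {suc n} p with p zero
... | true  = cong suc (count-complement (p ∘ suc))
... | false = trans (+-suc _ _) (cong suc (count-complement (p ∘ suc)))

count≤n : ∀ {n} (p : Fin n → Bool) → count p ≤ n
count≤n p = subst (count p ≤_) (count-complement p) (m≤m+n _ _)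

count≡0⇒≡false : ∀ {n} (p : Fin n → Bool) → count p ≡ 0 → ∀ i → p i ≡ false
count≡0⇒≡false p c≡0 zero with p zero
... | false = refl
count≡0⇒≡false p c≡0 (suc i) with p zero
... | false = count≡0⇒≡false (p ∘ suc) c≡0 i

count≡n⇒≡true : ∀ {n} (p : Fin n → Bool) → count p ≡ n → ∀ i → p i ≡ true
count≡n⇒≡true {n} p c≡n i = not-injective (count≡0⇒≡false (∁ p) ∁p≡0 i)
  where
  ∁p≡0 : count (∁ p) ≡ 0
  ∁p≡0 = +-cancelˡ-≡ (count p) _ 0 (trans (count-complement p) (trans (sym c≡n) (sym (+-identityʳ _))))

≡true⇒count≡n : ∀ {n} {p : Fin n → Bool} → (∀ i → p i ≡ true) → count p ≡ n
≡true⇒count≡n {n} {p} p≡true = begin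
    count p                ≡⟨ sym (+-identityʳ _) ⟩
    count p + 0            ≡⟨ cong (count p +_) (sym (≡false⇒count≡0 (λ i → cong not (p≡true i)))) ⟩
    count p + count (∁ p)  ≡⟨ count-complement p ⟩
    n                      ∎
  where open ≡-Reasoning

count-< : ∀ {n} {p q : Fin n → Bool} → p ⇒ᵇ q → ∀ j → q j ≡ true → p j ≡ false → count p < count q
count-< {suc n} {p} {q} p⇒q zero qj pj rewrite qj | pj = s≤s (count-mono (p⇒q ∘ suc))
count-< {suc n} {p} {q} p⇒q (suc j) qj pj =
  +-mono-≤-< (⟦⟧-mono (p⇒q zero)) (count-< (p⇒q ∘ suc) j qj pj)

⇒ᵇ-by-count : ∀ {n} {p q : Fin n → Bool} → p ⇒ᵇ q → count q ≤ count p → q ⇒ᵇ p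
⇒ᵇ-by-count {p = p} p⇒q q≤p i qi with p i in pi
... | true  = refl
... | false = contradiction q≤p (<⇒≱ (count-< p⇒q i qi pi))

find : ∀ {n} (p : Fin n → Bool) → (∃[ i ] p i ≡ true) ⊎ (∀ i → p i ≡ false)
find p with any? (λ i → p i ≟ᵇ true)
... | yes (i , pi) = inj₁ (i , pi)
... | no ∄i        = inj₂ λ i → ¬-not λ pi → ∄i (i , pi)

find₂ : ∀ {n} (q : Fin n → Fin n → Bool) → (∃[ u ] ∃[ v ] q u v ≡ true) ⊎ (∀ u v → q u v ≡ false)
find₂ q with any? (λ u → any? (λ v → q u v ≟ᵇ true))
... | yes (u , v , quv) = inj₁ (u , v , quv)
... | no ∄uv            = inj₂ λ u v → ¬-not λ quv → ∄uv (u , v , quv)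

#ˢ : ∀ {n} → (Vec Bool n → Bool) → ℕ
#ˢ {n} P = countᴸ P (allSubsets n)

module _ {n : ℕ} where

  #ˢ-cong : ∀ {P Q : Vec Bool n → Bool} → (∀ S → P S ≡ Q S) → #ˢ P ≡ #ˢ Q
  #ˢ-cong P≡Q = countᴸ-cong P≡Q (allSubsets n)

  #ˢ-mono : ∀ {P Q : Vec Bool n → Bool} → P ⇒ᵇ Q → #ˢ P ≤ #ˢ Q
  #ˢ-mono P⇒Q = countᴸ-mono P⇒Q (allSubsets n)

  #ˢ-split : ∀ (P Q : Vec Bool n → Bool) → #ˢ P ≡ #ˢ (λ S → P S ∧ Q S) + #ˢ (λ S → P S ∧ not (Q S))
  #ˢ-split P Q = countᴸ-split P Q (allSubsets n)

  numIndep≡#ˢ : (G : Graph n) → numIndep G ≡ #ˢ (isIndependent G)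
  numIndep≡#ˢ G = length-filterᵇ (isIndependent G) (allSubsets n)

#ˢ-∷ : ∀ {n} (P : Vec Bool (suc n) → Bool) → #ˢ P ≡ #ˢ (P ∘ (false ∷_)) + #ˢ (P ∘ (true ∷_))
#ˢ-∷ {n} P = trans (countᴸ-++ P (map (false ∷_) (allSubsets n)) _)
                   (cong₂ _+_ (countᴸ-map P _ (allSubsets n)) (countᴸ-map P _ (allSubsets n)))

#ˢ-pos : ∀ {n} (P : Vec Bool n → Bool) S → P S ≡ true → 0 < #ˢ P
#ˢ-pos P []          PS rewrite PS = s≤s z≤n
#ˢ-pos P (false ∷ S) PS rewrite #ˢ-∷ P = <-≤-trans (#ˢ-pos (P ∘ (false ∷_)) S PS) (m≤m+n _ _)
#ˢ-pos P (true  ∷ S) PS rewrite #ˢ-∷ P = <-≤-trans (#ˢ-pos (P ∘ (true ∷_)) S PS) (m≤n+m _ _)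

toggle : ∀ {n} → Fin n → Vec Bool n → Vec Bool n
toggle i S = updateAt S i not

#ˢ-toggle : ∀ {n} (i : Fin n) (P : Vec Bool n → Bool) → #ˢ (P ∘ toggle i) ≡ #ˢ P
#ˢ-toggle zero    P = trans (#ˢ-∷ (P ∘ toggle zero)) (trans (+-comm (#ˢ (P ∘ (true ∷_))) _) (sym (#ˢ-∷ P)))
#ˢ-toggle (suc i) P = trans (#ˢ-∷ (P ∘ toggle (suc i)))
  (trans (cong₂ _+_ (#ˢ-toggle i (P ∘ (false ∷_))) (#ˢ-toggle i (P ∘ (true ∷_)))) (sym (#ˢ-∷ P)))

-- Toggling w is a bijection between the P-sets containing w and those avoiding it.
#ˢ-half : ∀ {n} (w : Fin n) (P : Vec Bool n → Bool) → (∀ S → P (toggle w S) ≡ P S) →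
  #ˢ P ≡ 2 * #ˢ (λ S → P S ∧ lookup S w)
#ˢ-half w P invariant = begin
    #ˢ P
  ≡⟨ #ˢ-split P (λ S → lookup S w) ⟩
    A + #ˢ (λ S → P S ∧ not (lookup S w))
  ≡⟨ cong (A +_) (#ˢ-cong (λ S → cong₂ _∧_ (sym (invariant S)) (sym (lookup∘updateAt w S)))) ⟩
    A + #ˢ ((λ S → P S ∧ lookup S w) ∘ toggle w)
  ≡⟨ cong (A +_) (trans (#ˢ-toggle w _) (sym (+-identityʳ A))) ⟩
    2 * A
  ∎
  where
  open ≡-Reasoning
  A = #ˢ (λ S → P S ∧ lookup S w)

#ˢ-avoiding-pair : ∀ {n} {u v : Fin n} (P : Vec Bool n → Bool) → u ≢ v →
  (∀ S → P (toggle u S) ≡ P S) → (∀ S → P (toggle v S) ≡ P S) →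
  #ˢ (λ S → P S ∧ not (lookup S u ∧ lookup S v)) * 4 ≡ #ˢ P * 3
#ˢ-avoiding-pair {u = u} {v} P u≢v u-invariant v-invariant
  = trans (cong (_* 4) B≡3A) (trans (12A A) (cong (_* 3) (sym #P≡4A)))
  where
  A = #ˢ (λ S → P S ∧ (lookup S u ∧ lookup S v))
  B = #ˢ (λ S → P S ∧ not (lookup S u ∧ lookup S v))
  Pu-v-invariant : ∀ S → P (toggle v S) ∧ lookup (toggle v S) u ≡ P S ∧ lookup S u
  Pu-v-invariant S = cong₂ _∧_ (v-invariant S) (lookup∘updateAt′ u v u≢v S)
  #P≡4A : #ˢ P ≡ 4 * A
  #P≡4A = begin
      #ˢ P
    ≡⟨ #ˢ-half u P u-invariant ⟩
      2 * #ˢ (λ S → P S ∧ lookup S u)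
    ≡⟨ cong (2 *_) (#ˢ-half v _ Pu-v-invariant) ⟩
      2 * (2 * #ˢ (λ S → (P S ∧ lookup S u) ∧ lookup S v))
    ≡⟨ cong (λ x → 2 * (2 * x)) (#ˢ-cong (λ S → ∧-assoc (P S) _ _)) ⟩
      2 * (2 * A)
    ≡⟨ sym (*-assoc 2 2 A) ⟩
      4 * A
    ∎
    where open ≡-Reasoning
  B≡3A : B ≡ 3 * A
  B≡3A = +-cancelʳ-≡ A B (3 * A) (begin
      B + A                 ≡⟨ +-comm B A ⟩
      A + B                 ≡⟨ sym (#ˢ-split P (λ S → lookup S u ∧ lookup S v)) ⟩
      #ˢ P                  ≡⟨ #P≡4A ⟩
      4 * A                 ≡⟨ +-comm A (3 * A) ⟩
      3 * A + A             ∎)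
    where open ≡-Reasoning
  12A : ∀ a → 3 * a * 4 ≡ 4 * a * 3
  12A = solve-∀

infix 7 _⊆ᵇ_

_⊆ᵇ_ : ∀ {n} → Vec Bool n → (Fin n → Bool) → Bool
[]      ⊆ᵇ Y = true
(b ∷ S) ⊆ᵇ Y = (not b ∨ Y zero) ∧ (S ⊆ᵇ Y ∘ suc)

⊆ᵇ-sound : ∀ {n} (S : Vec Bool n) {Y} → S ⊆ᵇ Y ≡ true → ∀ i → lookup S i ≡ true → Y i ≡ true
⊆ᵇ-sound (true ∷ S) {Y} S⊆Y zero    _  with Y zero
... | true = refl
⊆ᵇ-sound (b    ∷ S) {Y} S⊆Y (suc i) Si = ⊆ᵇ-sound S (∧-conicalʳ (not b ∨ Y zero) _ S⊆Y) i Si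

⊆ᵇ-complete : ∀ {n} (S : Vec Bool n) {Y} → (∀ i → lookup S i ≡ true → Y i ≡ true) → S ⊆ᵇ Y ≡ true
⊆ᵇ-complete []          S⊆Y = refl
⊆ᵇ-complete (false ∷ S) S⊆Y = ⊆ᵇ-complete S (S⊆Y ∘ suc)
⊆ᵇ-complete (true  ∷ S) S⊆Y rewrite S⊆Y zero refl = ⊆ᵇ-complete S (S⊆Y ∘ suc)

⊈ᵇ-witness : ∀ {n} (S : Vec Bool n) {Y} → S ⊆ᵇ Y ≡ false → ∃[ i ] lookup S i ≡ true × Y i ≡ false
⊈ᵇ-witness (b ∷ S) {Y} S⊈Y with b | Y zero in Y₀
... | true  | false = zero , refl , Y₀
... | true  | true  = let i , Si , Yi = ⊈ᵇ-witness S S⊈Y in suc i , Si , Yi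
... | false | _     = let i , Si , Yi = ⊈ᵇ-witness S S⊈Y in suc i , Si , Yi

⊆ᵇ-∧ : ∀ {n} (S : Vec Bool n) Y Y′ → (S ⊆ᵇ Y) ∧ (S ⊆ᵇ Y′) ≡ S ⊆ᵇ (λ i → Y i ∧ Y′ i)
⊆ᵇ-∧ []      Y Y′ = refl
⊆ᵇ-∧ (b ∷ S) Y Y′ with b | Y zero | Y′ zero | ⊆ᵇ-∧ S (Y ∘ suc) (Y′ ∘ suc)
... | false | _     | _     | IH = IH
... | true  | false | _     | IH = refl
... | true  | true  | true  | IH = IH
... | true  | true  | false | IH = ∧-zeroʳ _

toggle-⊆ᵇ : ∀ {n} (w : Fin n) S {Y} → Y w ≡ true → toggle w S ⊆ᵇ Y ≡ S ⊆ᵇ Y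
toggle-⊆ᵇ zero    (b ∷ S) Yw rewrite Yw | ∨-zeroʳ (not (not b)) | ∨-zeroʳ (not b) = refl
toggle-⊆ᵇ (suc w) (b ∷ S) {Y} Yw = cong ((not b ∨ Y zero) ∧_) (toggle-⊆ᵇ w S Yw)

#ˢ-⊆ᵇ : ∀ {n} (Y : Fin n → Bool) → #ˢ (_⊆ᵇ Y) ≡ 2 ^ count Y
#ˢ-⊆ᵇ {zero}  Y = refl
#ˢ-⊆ᵇ {suc n} Y = trans (#ˢ-∷ (_⊆ᵇ Y)) (step (Y zero))
  where
  IH = #ˢ-⊆ᵇ (Y ∘ suc)
  step : ∀ y → #ˢ (_⊆ᵇ Y ∘ suc) + #ˢ (λ S → y ∧ (S ⊆ᵇ Y ∘ suc)) ≡ 2 ^ (⟦ y ⟧ + count (Y ∘ suc))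
  step true  = trans (cong₂ _+_ IH IH) (cong (2 ^ count (Y ∘ suc) +_) (sym (+-identityʳ _)))
  step false = trans (cong₂ _+_ IH (countᴸ-false (λ _ → refl) (allSubsets n))) (+-identityʳ _)

-- For S ⊆ Y, not (S ⊆ᵇ ∁ Y) says that S is nonempty.
#ˢ-nonempty-⊆ᵇ : ∀ {n} (Y : Fin n → Bool) → #ˢ (λ S → S ⊆ᵇ Y ∧ not (S ⊆ᵇ ∁ Y)) + 1 ≡ 2 ^ count Y
#ˢ-nonempty-⊆ᵇ {n} Y = begin
    #ˢ (λ S → S ⊆ᵇ Y ∧ not (S ⊆ᵇ ∁ Y)) + 1
  ≡⟨ cong (#ˢ (λ S → S ⊆ᵇ Y ∧ not (S ⊆ᵇ ∁ Y)) +_) (sym only-∅) ⟩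
    #ˢ (λ S → S ⊆ᵇ Y ∧ not (S ⊆ᵇ ∁ Y)) + #ˢ (λ S → S ⊆ᵇ Y ∧ S ⊆ᵇ ∁ Y)
  ≡⟨ trans (+-comm (#ˢ (λ S → S ⊆ᵇ Y ∧ not (S ⊆ᵇ ∁ Y))) _) (sym (#ˢ-split (_⊆ᵇ Y) (_⊆ᵇ ∁ Y))) ⟩
    #ˢ (_⊆ᵇ Y)
  ≡⟨ #ˢ-⊆ᵇ Y ⟩
    2 ^ count Y
  ∎
  where
  open ≡-Reasoning
  only-∅ : #ˢ (λ S → S ⊆ᵇ Y ∧ S ⊆ᵇ ∁ Y) ≡ 1
  only-∅ = begin
    #ˢ (λ S → S ⊆ᵇ Y ∧ S ⊆ᵇ ∁ Y)        ≡⟨ #ˢ-cong (λ S → ⊆ᵇ-∧ S Y (∁ Y)) ⟩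
    #ˢ (_⊆ᵇ λ i → Y i ∧ not (Y i))     ≡⟨ #ˢ-⊆ᵇ (λ i → Y i ∧ not (Y i)) ⟩
    2 ^ count (λ i → Y i ∧ not (Y i))  ≡⟨ cong (2 ^_) (≡false⇒count≡0 (λ i → ∧-inverseʳ (Y i))) ⟩
    1                                  ∎

≡ᵇ-sound : ∀ {m n} → (m ≡ᵇ n) ≡ true → m ≡ n
≡ᵇ-sound {m} {n} e = ≡ᵇ⇒≡ m n (Equivalence.from T-≡ e)

≡ᵇ-complete : ∀ {m n} → m ≡ n → (m ≡ᵇ n) ≡ true
≡ᵇ-complete {m} {n} e = Equivalence.to T-≡ (≡⇒≡ᵇ m n e)

module _ {n : ℕ} (G : Graph n) where

  isIndependent-sound : ∀ S → isIndependent G S ≡ true →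
    ∀ u v → lookup S u ≡ true → lookup S v ≡ true → adj G u v ≡ false
  isIndependent-sound S indep u v Su Sv = begin
      adj G u v
    ≡⟨ cong₂ (λ a b → a ∧ b ∧ adj G u v) Su Sv ⟨
      lookup S u ∧ lookup S v ∧ adj G u v
    ≡⟨ count≡0⇒≡false _ (≡ᵇ-sound (count≡n⇒≡true _ (≡ᵇ-sound indep) u)) v ⟩
      false
    ∎
    where open ≡-Reasoning

  isIndependent-complete : ∀ S →
    (∀ u v → lookup S u ≡ true → lookup S v ≡ true → adj G u v ≡ false) → isIndependent G S ≡ true
  isIndependent-complete S no-edge =
    ≡ᵇ-complete (≡true⇒count≡n (λ u → ≡ᵇ-complete (≡false⇒count≡0 (no-edge-at u))))
    where
    no-edge-at : ∀ u v → lookup S u ∧ lookup S v ∧ adj G u v ≡ false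
    no-edge-at u v with lookup S u in Su | lookup S v in Sv
    ... | true  | true  = no-edge u v Su Sv
    ... | true  | false = refl
    ... | false | _     = refl

  indep-∌-edge : ∀ S → isIndependent G S ≡ true →
    ∀ {u v} → adj G u v ≡ true → lookup S u ∧ lookup S v ≡ false
  indep-∌-edge S indep {u} {v} edge = ¬-not λ both →
    not-¬ edge (isIndependent-sound S indep u v (∧-conicalˡ _ _ both) (∧-conicalʳ (lookup S u) _ both))

  -- An independent set containing w lies in the non-neighbourhood of w, and half of those subsets contain w.
  #indep-∋ : ∀ w {D} → D ≤ degree G w → #ˢ (λ S → isIndependent G S ∧ lookup S w) * 2 ^ suc D ≤ 2 ^ n
  #indep-∋ w {D} D≤deg = begin
      #ˢ (λ S → isIndependent G S ∧ lookup S w) * 2 ^ suc D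
    ≤⟨ *-monoˡ-≤ (2 ^ suc D) (#ˢ-mono indep⇒⊆Y) ⟩
      B * (2 * 2 ^ D)
    ≡⟨ *-assoc B 2 (2 ^ D) ⟨
      B * 2 * 2 ^ D
    ≡⟨ cong (_* 2 ^ D) (trans (*-comm B 2) (sym 2B≡2^|Y|)) ⟩
      2 ^ count Y * 2 ^ D
    ≤⟨ *-monoʳ-≤ (2 ^ count Y) (^-monoʳ-≤ 2 D≤deg) ⟩
      2 ^ count Y * 2 ^ degree G w
    ≡⟨ ^-distribˡ-+-* 2 (count Y) _ ⟨
      2 ^ (count Y + degree G w)
    ≡⟨ cong (2 ^_) (trans (+-comm (count Y) _) (count-complement (adj G w))) ⟩
      2 ^ n
    ∎
    where
    open ≤-Reasoning
    Y : Fin n → Bool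
    Y = ∁ (adj G w)
    B = #ˢ (λ S → S ⊆ᵇ Y ∧ lookup S w)
    2B≡2^|Y| : 2 ^ count Y ≡ 2 * B
    2B≡2^|Y| = trans (sym (#ˢ-⊆ᵇ Y)) (#ˢ-half w (_⊆ᵇ Y) (λ S → toggle-⊆ᵇ w S (cong not (irrfl G w))))
    indep⇒⊆Y : (λ S → isIndependent G S ∧ lookup S w) ⇒ᵇ (λ S → S ⊆ᵇ Y ∧ lookup S w)
    indep⇒⊆Y S indep∋w = cong₂ _∧_ S⊆Y Sw
      where
      Sw = ∧-conicalʳ (isIndependent G S) _ indep∋w
      S⊆Y = ⊆ᵇ-complete S λ v Sv →
        cong not (isIndependent-sound S (∧-conicalˡ _ _ indep∋w) w v Sw Sv)

  #indep-meeting : ∀ (Z : Fin n → Bool) {D} → (∀ w → Z w ≡ true → D ≤ degree G w) →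
    #ˢ (λ S → isIndependent G S ∧ not (S ⊆ᵇ ∁ Z)) * 2 ^ suc D ≤ count Z * 2 ^ n
  #indep-meeting Z high = union-bound Z (λ w S → isIndependent G S ∧ lookup S w) _ (allSubsets n)
    (λ w Zw → #indep-∋ w (high w Zw)) meets
    where
    meets : ∀ S → isIndependent G S ∧ not (S ⊆ᵇ ∁ Z) ≡ true →
      ∃[ w ] Z w ≡ true × isIndependent G S ∧ lookup S w ≡ true
    meets S indep∧meets with ⊈ᵇ-witness S (not-injective (∧-conicalʳ (isIndependent G S) _ indep∧meets))
    ... | w , Sw , Zw = w , not-injective Zw , cong₂ _∧_ (∧-conicalˡ _ _ indep∧meets) Sw

pair : ∀ {n} → Fin n → Fin n → Vec Bool n
pair u v = tabulate (λ i → does (i ≟ u) ∨ does (i ≟ v))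

module _ {n : ℕ} (u v : Fin n) where

  pair-∋ˡ : lookup (pair u v) u ≡ true
  pair-∋ˡ rewrite lookup∘tabulate (λ i → does (i ≟ u) ∨ does (i ≟ v)) u | dec-true (u ≟ u) refl = refl

  pair-∋ʳ : lookup (pair u v) v ≡ true
  pair-∋ʳ rewrite lookup∘tabulate (λ i → does (i ≟ u) ∨ does (i ≟ v)) v | dec-true (v ≟ v) refl =
    ∨-zeroʳ (does (v ≟ u))

  pair-⊆ᵇ : ∀ {Y} → Y u ≡ true → Y v ≡ true → pair u v ⊆ᵇ Y ≡ true
  pair-⊆ᵇ {Y} Yu Yv = ⊆ᵇ-complete (pair u v) λ i i∈pair →
    member i (trans (sym (lookup∘tabulate (λ i → does (i ≟ u) ∨ does (i ≟ v)) i)) i∈pair)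
    where
    member : ∀ i → does (i ≟ u) ∨ does (i ≟ v) ≡ true → Y i ≡ true
    member i _ with i ≟ u | i ≟ v
    member i _ | yes refl | _        = Yu
    member i _ | no _     | yes refl = Yv

#ˢ-< : ∀ {n} {P Q : Vec Bool n → Bool} → P ⇒ᵇ Q → ∀ S → Q S ≡ true → P S ≡ false → #ˢ P < #ˢ Q
#ˢ-< {P = P} {Q} P⇒Q S QS PS = begin-strict
    #ˢ P
  ≡⟨ +-identityʳ (#ˢ P) ⟨
    #ˢ P + 0
  <⟨ +-mono-≤-< (#ˢ-mono λ S PS → cong₂ _∧_ (P⇒Q S PS) PS) (#ˢ-pos _ S (cong₂ _∧_ QS (cong not PS))) ⟩
    #ˢ (λ S → Q S ∧ P S) + #ˢ (λ S → Q S ∧ not (P S))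
  ≡⟨ #ˢ-split Q P ⟨
    #ˢ Q
  ∎
  where open ≤-Reasoning

-- Graphs close to a complete bipartite graph

module _ {n : ℕ} (G : Graph n) where

  EdgeFree : (Fin n → Bool) → Set
  EdgeFree p = ∀ u v → p u ≡ true → p v ≡ true → adj G u v ≡ false

  no-edge⇒EdgeFree : ∀ {p : Fin n → Bool} → (∀ u v → p u ∧ p v ∧ adj G u v ≡ false) → EdgeFree p
  no-edge⇒EdgeFree no-edge u v pu pv = trans (sym (cong₂ (λ a b → a ∧ b ∧ adj G u v) pu pv)) (no-edge u v)

  FullyJoined : (Fin n → Bool) → (Fin n → Bool) → Set
  FullyJoined p q = ∀ u v → p u ≡ true → q v ≡ true → adj G u v ≡ true

module _ {n : ℕ} (G : Graph n) (H : Fin n → Bool) where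

  private
    Indep = isIndependent G
    Meets : Vec Bool n → Bool
    Meets S = not (S ⊆ᵇ ∁ H)

  #indep-via-meeting : ∀ {m} →
    #ˢ (λ S → Indep S ∧ Meets S) + m ≤ #ˢ (λ S → S ⊆ᵇ H ∧ Meets S) →
    m + #ˢ Indep < 2 ^ count (∁ H) + 2 ^ count H
  #indep-via-meeting {m} meeting≤ = begin-strict
      m + #ˢ Indep
    ≡⟨ cong (m +_) (#ˢ-split Indep (_⊆ᵇ ∁ H)) ⟩
      m + (a + b)
    <⟨ n<1+n _ ⟩
      suc (m + (a + b))
    ≡⟨ reassociate a b m ⟩
      a + (b + m + 1)
    ≤⟨ +-mono-≤ (≤-trans (#ˢ-mono (λ S → ∧-conicalʳ (Indep S) _)) (≤-reflexive (#ˢ-⊆ᵇ (∁ H))))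
                (+-monoˡ-≤ 1 meeting≤) ⟩
      2 ^ count (∁ H) + (#ˢ (λ S → S ⊆ᵇ H ∧ Meets S) + 1)
    ≡⟨ cong (2 ^ count (∁ H) +_) (#ˢ-nonempty-⊆ᵇ H) ⟩
      2 ^ count (∁ H) + 2 ^ count H
    ∎
    where
    open ≤-Reasoning
    a = #ˢ (λ S → Indep S ∧ S ⊆ᵇ ∁ H)
    b = #ˢ (λ S → Indep S ∧ Meets S)
    reassociate : ∀ a b m → suc (m + (a + b)) ≡ a + (b + m + 1)
    reassociate = solve-∀

  -- A vertex of S outside H would be adjacent to every vertex of S in H.
  meeting-indep-⊆ᵇ : FullyJoined G (∁ H) H → (λ S → Indep S ∧ Meets S) ⇒ᵇ (λ S → S ⊆ᵇ H ∧ Meets S)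
  meeting-indep-⊆ᵇ joined S indep∧meets
    with h , Sh , Hh ← ⊈ᵇ-witness S (not-injective (∧-conicalʳ (Indep S) _ indep∧meets))
    = cong₂ _∧_ (⊆ᵇ-complete S in-H) (∧-conicalʳ (Indep S) _ indep∧meets)
    where
    in-H : ∀ u → lookup S u ≡ true → H u ≡ true
    in-H u Su with H u in Hu
    ... | true  = refl
    ... | false = contradiction
      (isIndependent-sound G S (∧-conicalˡ _ _ indep∧meets) u h Su Sh)
      (not-¬ (joined u h (cong not Hu) (not-injective Hh)))

  meeting-indep-< : FullyJoined G (∁ H) H → ∀ {h h′} → H h ≡ true → H h′ ≡ true → adj G h h′ ≡ true →
    #ˢ (λ S → Indep S ∧ Meets S) + 1 ≤ #ˢ (λ S → S ⊆ᵇ H ∧ Meets S)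
  meeting-indep-< joined {h} {h′} Hh Hh′ edge = subst (_≤ #ˢ (λ S → S ⊆ᵇ H ∧ Meets S)) (+-comm 1 _)
    (#ˢ-< (meeting-indep-⊆ᵇ joined) (pair h h′) (cong₂ _∧_ (pair-⊆ᵇ h h′ Hh Hh′) pair-meets) pair-dependent)
    where
    pair-meets : Meets (pair h h′) ≡ true
    pair-meets = cong not (¬-not λ ⊆∁H →
      not-¬ Hh (not-injective (⊆ᵇ-sound (pair h h′) ⊆∁H h (pair-∋ˡ h h′))))
    pair-dependent : Indep (pair h h′) ∧ Meets (pair h h′) ≡ false
    pair-dependent = cong (_∧ Meets (pair h h′)) (¬-not λ indep →
      not-¬ edge (isIndependent-sound G (pair h h′) indep h h′ (pair-∋ˡ h h′) (pair-∋ʳ h h′)))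

  adj≡xor : EdgeFree G H → EdgeFree G (∁ H) → FullyJoined G (∁ H) H → ∀ u v → adj G u v ≡ H u xor H v
  adj≡xor H-free ∁H-free joined u v with H u in Hu | H v in Hv
  ... | true  | true  = H-free u v Hu Hv
  ... | false | false = ∁H-free u v (cong not Hu) (cong not Hv)
  ... | false | true  = joined u v (cong not Hu) Hv
  ... | true  | false = trans (Graph.sym G u v) (joined v u (cong not Hv) Hu)

  ⊆ᵇ-indep : ∀ {Y} → EdgeFree G Y → ∀ S → S ⊆ᵇ Y ≡ true → Indep S ≡ true
  ⊆ᵇ-indep free S S⊆Y = isIndependent-complete G S λ u v Su Sv →
    free u v (⊆ᵇ-sound S S⊆Y u Su) (⊆ᵇ-sound S S⊆Y v Sv)

  #indep-≥ : EdgeFree G H → EdgeFree G (∁ H) → 2 ^ count (∁ H) + 2 ^ count H ≤ #ˢ Indep + 1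
  #indep-≥ H-free ∁H-free = begin
      2 ^ count (∁ H) + 2 ^ count H
    ≡⟨ cong₂ _+_ (#ˢ-⊆ᵇ (∁ H)) (#ˢ-nonempty-⊆ᵇ H) ⟨
      #ˢ (_⊆ᵇ ∁ H) + (#ˢ (λ S → S ⊆ᵇ H ∧ Meets S) + 1)
    ≤⟨ +-mono-≤ (#ˢ-mono (λ S S⊆∁H → cong₂ _∧_ (⊆ᵇ-indep ∁H-free S S⊆∁H) S⊆∁H))
                (+-monoˡ-≤ 1 (#ˢ-mono λ S S⊆H∧meets →
                  cong₂ _∧_ (⊆ᵇ-indep H-free S (∧-conicalˡ _ _ S⊆H∧meets)) (∧-conicalʳ (S ⊆ᵇ H) _ S⊆H∧meets))) ⟩
      #ˢ (λ S → Indep S ∧ S ⊆ᵇ ∁ H) + (#ˢ (λ S → Indep S ∧ Meets S) + 1)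
    ≡⟨ +-assoc (#ˢ (λ S → Indep S ∧ S ⊆ᵇ ∁ H)) _ 1 ⟨
      #ˢ (λ S → Indep S ∧ S ⊆ᵇ ∁ H) + #ˢ (λ S → Indep S ∧ Meets S) + 1
    ≡⟨ cong (_+ 1) (#ˢ-split Indep (_⊆ᵇ ∁ H)) ⟨
      #ˢ Indep + 1
    ∎
    where open ≤-Reasoning

-- Matchings and vertex covers

Edges : ℕ → Set
Edges n = List (Fin n × Fin n)

covers : ∀ {n} → Edges n → Fin n → Bool
covers []             i = false
covers ((u , v) ∷ es) i = does (i ≟ u) ∨ does (i ≟ v) ∨ covers es i

avoids : ∀ {n} → Edges n → Vec Bool n → Bool
avoids []             S = true
avoids ((u , v) ∷ es) S = avoids es S ∧ not (lookup S u ∧ lookup S v)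

Matching : ∀ {n} → Graph n → Edges n → Set
Matching G []             = ⊤
Matching G ((u , v) ∷ es) = adj G u v ≡ true × covers es u ≡ false × covers es v ≡ false × Matching G es

VertexCover : ∀ {n} → Graph n → (Fin n → Bool) → Set
VertexCover G W = ∀ u v → adj G u v ≡ true → W u ∨ W v ≡ true

count-≟ : ∀ {n} (u : Fin n) → count (λ i → does (i ≟ u)) ≡ 1
count-≟ {suc n} zero    = cong suc (≡false⇒count≡0 {n} λ _ → refl)
count-≟ {suc n} (suc u) = count-≟ u

count-covers : ∀ {n} (es : Edges n) → count (covers es) ≤ 2 * length es
count-covers {n} []         = ≤-reflexive (≡false⇒count≡0 {n} λ _ → refl)
count-covers ((u , v) ∷ es) = begin
    count (covers ((u , v) ∷ es))
  ≤⟨ count-∨ (λ i → does (i ≟ u)) _ ⟩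
    count (λ i → does (i ≟ u)) + count (λ i → does (i ≟ v) ∨ covers es i)
  ≤⟨ +-monoʳ-≤ _ (count-∨ (λ i → does (i ≟ v)) (covers es)) ⟩
    count (λ i → does (i ≟ u)) + (count (λ i → does (i ≟ v)) + count (covers es))
  ≤⟨ +-mono-≤ (≤-reflexive (count-≟ u)) (+-mono-≤ (≤-reflexive (count-≟ v)) (count-covers es)) ⟩
    1 + (1 + 2 * length es)
  ≡⟨ *-suc 2 (length es) ⟨
    2 * suc (length es)
  ∎
  where open ≤-Reasoning

-- Greedily extend a matching by an edge avoiding its vertices; once that fails,
-- the matched vertices cover every edge.
matching-or-cover : ∀ {n} (G : Graph n) k →
  (∃[ es ] length es ≡ k × Matching G es) ⊎ (∃[ W ] count W ≤ 2 * k × VertexCover G W)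
matching-or-cover G zero = inj₁ ([] , refl , tt)
matching-or-cover G (suc k) with matching-or-cover G k
... | inj₂ (W , |W|≤2k , cover) = inj₂ (W , ≤-trans |W|≤2k (*-monoʳ-≤ 2 (n≤1+n k)) , cover)
... | inj₁ (es , refl , matching)
    with find₂ (λ u v → not (covers es u) ∧ not (covers es v) ∧ adj G u v)
...   | inj₁ (u , v , fresh) =
        inj₁ ((u , v) ∷ es , refl , ∧-conicalʳ _ _ (∧-conicalʳ (not (covers es u)) _ fresh) ,
              not-injective (∧-conicalˡ _ _ fresh) ,
              not-injective (∧-conicalˡ _ (adj G u v) (∧-conicalʳ (not (covers es u)) _ fresh)) ,
              matching)
...   | inj₂ no-fresh = inj₂ (covers es , ≤-trans (count-covers es) (*-monoʳ-≤ 2 (n≤1+n k)) , cover)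
  where
  cover : VertexCover G (covers es)
  cover u v edge with covers es u | covers es v | no-fresh u v
  ... | true  | _     | _          = refl
  ... | false | true  | _          = refl
  ... | false | false | no-edge = contradiction (trans (sym edge) no-edge) λ ()

edge⇒≢ : ∀ {n} (G : Graph n) {u v} → adj G u v ≡ true → u ≢ v
edge⇒≢ G edge refl = contradiction (trans (sym edge) (irrfl G _)) λ ()

toggle-avoids : ∀ {n} (es : Edges n) w S → covers es w ≡ false → avoids es (toggle w S) ≡ avoids es S
toggle-avoids []             w S _ = refl
toggle-avoids ((u , v) ∷ es) w S uncovered with w ≟ u | w ≟ v
... | no w≢u | no w≢v = cong₂ _∧_ (toggle-avoids es w S uncovered)
  (cong not (cong₂ _∧_ (lookup∘updateAt′ u w (w≢u ∘ sym) S) (lookup∘updateAt′ v w (w≢v ∘ sym) S)))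

#ˢ-all : ∀ {n} → #ˢ {n} (λ _ → true) ≡ 2 ^ n
#ˢ-all {n} = begin
  #ˢ {n} (λ _ → true)            ≡⟨ #ˢ-cong {n} (λ S → sym (⊆ᵇ-complete S (λ _ _ → refl))) ⟩
  #ˢ {n} (_⊆ᵇ λ _ → true)        ≡⟨ #ˢ-⊆ᵇ {n} (λ _ → true) ⟩
  2 ^ count {n} (λ _ → true)     ≡⟨ cong (2 ^_) (≡true⇒count≡n {n} (λ _ → refl)) ⟩
  2 ^ n                          ∎
  where open ≡-Reasoning

-- Each matching edge independently excludes a quarter of the vertex subsets.
#ˢ-avoids : ∀ {n} (G : Graph n) es → Matching G es → #ˢ (avoids es) * 4 ^ length es ≡ 3 ^ length es * 2 ^ n
#ˢ-avoids {n} G [] _ = trans (*-identityʳ _) (trans (#ˢ-all {n}) (sym (*-identityˡ _)))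
#ˢ-avoids {n} G ((u , v) ∷ es) (edge , u-free , v-free , matching) = begin
    A′ * (4 * 4 ^ k)
  ≡⟨ *-assoc A′ 4 (4 ^ k) ⟨
    A′ * 4 * 4 ^ k
  ≡⟨ cong (_* 4 ^ k) (#ˢ-avoiding-pair (avoids es) (edge⇒≢ G edge)
       (λ S → toggle-avoids es u S u-free) (λ S → toggle-avoids es v S v-free)) ⟩
    A * 3 * 4 ^ k
  ≡⟨ trans (*-assoc A 3 (4 ^ k)) (trans (cong (A *_) (*-comm 3 (4 ^ k))) (sym (*-assoc A (4 ^ k) 3))) ⟩
    A * 4 ^ k * 3
  ≡⟨ cong (_* 3) (#ˢ-avoids G es matching) ⟩
    3 ^ k * 2 ^ n * 3
  ≡⟨ trans (*-comm (3 ^ k * 2 ^ n) 3) (sym (*-assoc 3 (3 ^ k) (2 ^ n))) ⟩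
    3 * 3 ^ k * 2 ^ n
  ∎
  where
  open ≡-Reasoning
  k = length es
  A = #ˢ (avoids es)
  A′ = #ˢ (avoids ((u , v) ∷ es))

indep⇒avoids : ∀ {n} (G : Graph n) es → Matching G es → isIndependent G ⇒ᵇ avoids es
indep⇒avoids G []             _                     S indep = refl
indep⇒avoids G ((u , v) ∷ es) (edge , _ , _ , matching) S indep =
  cong₂ _∧_ (indep⇒avoids G es matching S indep) (cong not (indep-∌-edge G S indep edge))

#indep-matching : ∀ {n} (G : Graph n) es → Matching G es →
  #ˢ (isIndependent G) * 4 ^ length es ≤ 3 ^ length es * 2 ^ n
#indep-matching G es matching =
  ≤-trans (*-monoˡ-≤ _ (#ˢ-mono (indep⇒avoids G es matching))) (≤-reflexive (#ˢ-avoids G es matching))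

-- Graphs determined by a vertex 2-colouring

count≡sum : ∀ {n} (p : Fin n → Bool) → count p ≡ sum (⟦_⟧ ∘ p)
count≡sum {zero}  p = refl
count≡sum {suc n} p = cong (⟦ p zero ⟧ +_) (count≡sum (p ∘ suc))

count-permute : ∀ {n} (p : Fin n → Bool) (π : Permutation′ n) → count (p ∘ (π ⟨$⟩ʳ_)) ≡ count p
count-permute p π = begin
  count (p ∘ (π ⟨$⟩ʳ_))      ≡⟨ count≡sum (p ∘ (π ⟨$⟩ʳ_)) ⟩
  sum (⟦_⟧ ∘ p ∘ (π ⟨$⟩ʳ_))  ≡⟨ sum-permute (⟦_⟧ ∘ p) π ⟨
  sum (⟦_⟧ ∘ p)              ≡⟨ count≡sum p ⟨
  count p                    ∎
  where open ≡-Reasoning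

value-attained : ∀ {n} (p q : Fin (suc n) → Bool) → count p ≡ count q → ∃[ j ] q j ≡ p zero
value-attained {n} p q |p|≡|q| with p zero in p₀
... | true with find q
...   | inj₁ (j , qj) = j , qj
...   | inj₂ q≡false  = contradiction (trans |p|≡|q| (≡false⇒count≡0 q≡false)) λ ()
value-attained {n} p q |p|≡|q| | false with find (∁ q)
...   | inj₁ (j , ∁qj) = j , not-injective ∁qj
...   | inj₂ ∁q≡false  = contradiction (count≤n (p ∘ suc)) (<⇒≱ (≤-reflexive (sym |p∘suc|≡1+n)))
  where
  |p∘suc|≡1+n : count (p ∘ suc) ≡ suc n
  |p∘suc|≡1+n = trans |p|≡|q| (≡true⇒count≡n (λ i → not-injective (∁q≡false i)))

count-after-swap : ∀ {n} (p q : Fin (suc n) → Bool) j → q j ≡ p zero → count p ≡ count q →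
  count (p ∘ suc) ≡ count (q ∘ (transpose zero j ⟨$⟩ʳ_) ∘ suc)
count-after-swap p q j qj |p|≡|q| = +-cancelˡ-≡ ⟦ p zero ⟧ _ _ (begin
    count p   ≡⟨ |p|≡|q| ⟩
    count q   ≡⟨ count-permute q (transpose zero j) ⟨
    count q′  ≡⟨ cong (λ b → ⟦ b ⟧ + count (q′ ∘ suc)) qj ⟩
    ⟦ p zero ⟧ + count (q′ ∘ suc) ∎)
  where
  open ≡-Reasoning
  q′ = q ∘ (transpose zero j ⟨$⟩ʳ_)

-- Swap a vertex of the right colour to the front, then recurse on the remaining vertices.
permutation-from-count : ∀ {n} (p q : Fin n → Bool) → count p ≡ count q →
  Σ (Permutation′ n) λ π → ∀ i → p i ≡ q (π ⟨$⟩ʳ i)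
permutation-from-count {zero}  p q _ = idₚ , λ ()
permutation-from-count {suc n} p q |p|≡|q|
  with j , qj ← value-attained p q |p|≡|q|
  with σ , p≡q′∘σ ← permutation-from-count (p ∘ suc) (q ∘ (transpose zero j ⟨$⟩ʳ_) ∘ suc)
                      (count-after-swap p q j qj |p|≡|q|)
  = lift₀ σ ∘ₚ transpose zero j , λ { zero → sym qj ; (suc i) → p≡q′∘σ i }

≅-from-colouring : ∀ {n} (G G′ : Graph n) (p q : Fin n → Bool) →
  (∀ u v → adj G u v ≡ p u xor p v) → (∀ u v → adj G′ u v ≡ q u xor q v) →
  count p ≡ count q → G ≅ G′
≅-from-colouring G G′ p q adjG adjG′ |p|≡|q| with π , p≡q∘π ← permutation-from-count p q |p|≡|q| =
  π , λ u v → trans (adjG u v) (trans (cong₂ _xor_ (p≡q∘π u) (p≡q∘π v)) (sym (adjG′ _ _)))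

count-side : ∀ {n} δ → δ ≤ n → count (side {n} δ) ≡ δ
count-side {n}     zero    _         = ≡false⇒count≡0 {n} λ _ → refl
count-side {suc n} (suc δ) (s≤s δ≤n) = cong suc (count-side {n} δ δ≤n)

module _ {n δ : ℕ} (δ≤n : δ ≤ n) where

  δ+|∁side|≡n : δ + count (∁ (side {n} δ)) ≡ n
  δ+|∁side|≡n = trans (cong (_+ count (∁ (side {n} δ))) (sym (count-side δ δ≤n))) (count-complement (side δ))

  K-minDegree : δ + δ ≤ n → MinDegreeAtLeast δ (K n δ)
  K-minDegree 2δ≤n v with side {n} δ v
  ... | false = ≤-reflexive (sym (count-side δ δ≤n))
  ... | true  = +-cancelˡ-≤ δ δ _ (subst (δ + δ ≤_) (sym δ+|∁side|≡n) 2δ≤n)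

  K-#indep-≥ : 2 ^ count (∁ (side {n} δ)) + 2 ^ δ ≤ #ˢ (isIndependent (K n δ)) + 1
  K-#indep-≥ = subst (λ d → 2 ^ count (∁ (side {n} δ)) + 2 ^ d ≤ #ˢ (isIndependent (K n δ)) + 1)
    (count-side δ δ≤n)
    (#indep-≥ (K n δ) (side δ) same-side (λ u v su sv → same-side u v (not-injective su) (not-injective sv)))
    where
    same-side : ∀ {b} u v → side {n} δ u ≡ b → side {n} δ v ≡ b → side {n} δ u xor side δ v ≡ false
    same-side {b} u v su sv rewrite su | sv = xor-same b

matchingSize : ℕ → ℕ
matchingSize δ = 3 * δ + 1

matchingSize-suc : ∀ δ → matchingSize (suc δ) ≡ 3 + matchingSize δ
matchingSize-suc δ = step δ
  where
  step : ∀ δ → 3 * suc δ + 1 ≡ 3 + (3 * δ + 1)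
  step = solve-∀

degreeBound : ℕ → ℕ
degreeBound δ = 2 * δ + 3

-- 2k(D + 1) < n rules out a small cover dominated by low-degree vertices; 2δ ≤ n makes δ
-- the minimum degree of K n δ.
n₀ : ℕ → ℕ
n₀ δ = suc (2 * matchingSize δ * suc (degreeBound δ) + (δ + δ))

module _ {δ n : ℕ} (large : n₀ δ ≤ n) where

  n₀⇒2δ≤n : δ + δ ≤ n
  n₀⇒2δ≤n = ≤-trans (m≤n+m (δ + δ) (2 * matchingSize δ * suc (degreeBound δ))) (≤-trans (n≤1+n _) large)

  n₀⇒δ≤n : δ ≤ n
  n₀⇒δ≤n = ≤-trans (m≤m+n δ δ) n₀⇒2δ≤n

n<2^n : ∀ n → n < 2 ^ n
n<2^n zero    = s≤s z≤n
n<2^n (suc n) = +-mono-≤ (m^n>0 2 n) (≤-trans (n<2^n n) (≤-reflexive (sym (+-identityʳ _))))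

-- 3 · 54^δ < 4 · 64^δ
3^k*2^δ<4^k : ∀ δ → 3 ^ matchingSize δ * 2 ^ δ < 4 ^ matchingSize δ
3^k*2^δ<4^k zero    = ≤-refl
3^k*2^δ<4^k (suc δ) = subst (λ m → 3 ^ m * 2 ^ suc δ < 4 ^ m) (sym (matchingSize-suc δ)) (begin-strict
    3 ^ (3 + k) * (2 * 2 ^ δ)
  ≡⟨ 54-split (3 ^ k) (2 ^ δ) ⟩
    54 * (3 ^ k * 2 ^ δ)
  <⟨ *-monoʳ-< 54 (3^k*2^δ<4^k δ) ⟩
    54 * 4 ^ k
  ≤⟨ *-monoˡ-≤ (4 ^ k) (m≤m+n 54 10) ⟩
    64 * 4 ^ k
  ≡⟨ 64-split (4 ^ k) ⟩
    4 ^ (3 + k)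
  ∎)
  where
  open ≤-Reasoning
  k = matchingSize δ
  54-split : ∀ x y → 3 * (3 * (3 * x)) * (2 * y) ≡ 54 * (x * y)
  54-split = solve-∀
  64-split : ∀ z → 64 * z ≡ 4 * (4 * (4 * z))
  64-split = solve-∀

2k<2^[3+δ] : ∀ δ → 2 * matchingSize δ < 2 ^ (3 + δ)
2k<2^[3+δ] δ = begin-strict
    2 * matchingSize δ
  <⟨ m<m+n _ (s≤s z≤n) ⟩
    2 * matchingSize δ + (6 + 2 * δ)
  ≡⟨ 8[1+δ] δ ⟩
    8 * suc δ
  ≤⟨ *-monoʳ-≤ 8 (n<2^n δ) ⟩
    8 * 2 ^ δ
  ≡⟨ 8x (2 ^ δ) ⟩
    2 ^ (3 + δ)
  ∎
  where
  open ≤-Reasoning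
  8[1+δ] : ∀ δ → 2 * (3 * δ + 1) + (6 + 2 * δ) ≡ 8 * suc δ
  8[1+δ] = solve-∀
  8x : ∀ x → 8 * x ≡ 2 * (2 * (2 * x))
  8x = solve-∀

suc-degreeBound≡[1+δ]+[3+δ] : ∀ δ → suc (degreeBound δ) ≡ suc δ + (3 + δ)
suc-degreeBound≡[1+δ]+[3+δ] δ = step δ
  where
  step : ∀ δ → suc (2 * δ + 3) ≡ suc δ + (3 + δ)
  step = solve-∀

suc-degreeBound≡[2+δ]+[2+δ] : ∀ δ → suc (degreeBound δ) ≡ (2 + δ) + (2 + δ)
suc-degreeBound≡[2+δ]+[2+δ] δ = step δ
  where
  step : ∀ δ → suc (2 * δ + 3) ≡ (2 + δ) + (2 + δ)
  step = solve-∀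

δ<2^[2+δ] : ∀ δ → δ < 2 ^ (2 + δ)
δ<2^[2+δ] δ = <-≤-trans (n<2^n δ) (^-monoʳ-≤ 2 (m≤n+m δ 2))

split-below : ∀ {x y} n δ j {a b} → x * 2 ^ (j + δ) ≤ a * 2 ^ n → y * 2 ^ (j + δ) < b * 2 ^ n →
  a + b ≡ 2 ^ j → (x + y) * 2 ^ δ < 2 ^ n
split-below {x} {y} n δ j {a} {b} x-small y-small a+b≡2^j = *-cancelʳ-< (2 ^ j) _ _ (begin-strict
    (x + y) * 2 ^ δ * 2 ^ j
  ≡⟨ distribute x y (2 ^ j) (2 ^ δ) ⟩
    x * (2 ^ j * 2 ^ δ) + y * (2 ^ j * 2 ^ δ)
  ≡⟨ cong₂ (λ e f → x * e + y * f) (^-distribˡ-+-* 2 j δ) (^-distribˡ-+-* 2 j δ) ⟨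
    x * 2 ^ (j + δ) + y * 2 ^ (j + δ)
  <⟨ +-mono-≤-< x-small y-small ⟩
    a * 2 ^ n + b * 2 ^ n
  ≡⟨ *-distribʳ-+ (2 ^ n) a b ⟨
    (a + b) * 2 ^ n
  ≡⟨ trans (cong (_* 2 ^ n) a+b≡2^j) (*-comm (2 ^ j) _) ⟩
    2 ^ n * 2 ^ j
  ∎)
  where
  open ≤-Reasoning
  distribute : ∀ x y e f → (x + y) * f * e ≡ x * (e * f) + y * (e * f)
  distribute = solve-∀

drop-small-factor : ∀ {y c} n a b → y * 2 ^ (a + b) ≤ c * 2 ^ n → c < 2 ^ b → y * 2 ^ a < 2 ^ n
drop-small-factor {y} {c} n a b y-small c<2^b = *-cancelʳ-< (2 ^ b) _ _ (begin-strict
    y * 2 ^ a * 2 ^ b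
  ≡⟨ trans (*-assoc y _ _) (cong (y *_) (sym (^-distribˡ-+-* 2 a b))) ⟩
    y * 2 ^ (a + b)
  ≤⟨ y-small ⟩
    c * 2 ^ n
  <⟨ *-monoˡ-< (2 ^ n) {{m^n≢0 2 n}} c<2^b ⟩
    2 ^ b * 2 ^ n
  ≡⟨ *-comm (2 ^ b) _ ⟩
    2 ^ n * 2 ^ b
  ∎)
  where open ≤-Reasoning

below-K : ∀ {n δ} (G : Graph n) → δ ≤ n →
  #ˢ (isIndependent G) * 2 ^ δ < 2 ^ n → #ˢ (isIndependent G) < #ˢ (isIndependent (K n δ))
below-K {n} {δ} G δ≤n few = <-≤-trans (*-cancelʳ-< (2 ^ δ) _ _ (<-≤-trans few (≤-reflexive 2^n≡))) 2^a≤iK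
  where
  a = count (∁ (side {n} δ))
  2^n≡ : 2 ^ n ≡ 2 ^ a * 2 ^ δ
  2^n≡ = trans (cong (2 ^_) (sym (δ+|∁side|≡n δ≤n))) (trans (^-distribˡ-+-* 2 δ a) (*-comm (2 ^ δ) _))
  2^a≤iK : 2 ^ a ≤ #ˢ (isIndependent (K n δ))
  2^a≤iK = +-cancelʳ-≤ 1 _ _ (≤-trans (+-monoʳ-≤ (2 ^ a) (m^n>0 2 δ)) (K-#indep-≥ δ≤n))

module Extremal {δ n : ℕ} (large : n₀ δ ≤ n) (G : Graph n) (min-deg : MinDegreeAtLeast δ G) where

  private
    k = matchingSize δ
    D = degreeBound δ
    Indep = isIndependent G
    KIndep = isIndependent (K n δ)

  Outcome : Set
  Outcome = #ˢ Indep < #ˢ KIndep ⊎ (#ˢ Indep ≤ #ˢ KIndep × G ≅ K n δ)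

  private
    2k[D+1]<n : 2 * k * suc D < n
    2k[D+1]<n = ≤-trans (s≤s (m≤m+n _ (δ + δ))) large

    δ≤n : δ ≤ n
    δ≤n = n₀⇒δ≤n large

  few⇒below-K : #ˢ Indep * 2 ^ δ < 2 ^ n → Outcome
  few⇒below-K few = inj₁ (below-K G δ≤n few)

  few-indep-matching : ∀ es → length es ≡ k → Matching G es → #ˢ Indep * 2 ^ δ < 2 ^ n
  few-indep-matching es |es|≡k matching = *-cancelʳ-< (4 ^ k) _ _ (begin-strict
      #ˢ Indep * 2 ^ δ * 4 ^ k
    ≡⟨ swap (#ˢ Indep) (2 ^ δ) (4 ^ k) ⟩
      #ˢ Indep * 4 ^ k * 2 ^ δ
    ≤⟨ *-monoˡ-≤ (2 ^ δ) (subst (λ m → #ˢ Indep * 4 ^ m ≤ 3 ^ m * 2 ^ n) |es|≡k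
                                (#indep-matching G es matching)) ⟩
      3 ^ k * 2 ^ n * 2 ^ δ
    ≡⟨ swap (3 ^ k) (2 ^ n) (2 ^ δ) ⟩
      3 ^ k * 2 ^ δ * 2 ^ n
    <⟨ *-monoˡ-< (2 ^ n) {{m^n≢0 2 n}} (3^k*2^δ<4^k δ) ⟩
      4 ^ k * 2 ^ n
    ≡⟨ *-comm (4 ^ k) _ ⟩
      2 ^ n * 4 ^ k
    ∎)
    where
    open ≤-Reasoning
    swap : ∀ x y z → x * y * z ≡ x * z * y
    swap = solve-∀

  module _ (W : Fin n → Bool) (|W|≤2k : count W ≤ 2 * k) (cover : VertexCover G W) where

    high : Fin n → Bool
    high w = D ≤ᵇ degree G w

    Z : Fin n → Bool
    Z w = W w ∧ high w

    Z-high : ∀ w → Z w ≡ true → D ≤ degree G w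
    Z-high w Zw = ≤ᵇ⇒≤ D (degree G w) (Equivalence.from T-≡ (∧-conicalʳ (W w) _ Zw))

    |Z|≤2k : count Z ≤ 2 * k
    |Z|≤2k = ≤-trans (count-mono {p = Z} {q = W} λ w Zw → ∧-conicalˡ _ _ Zw) |W|≤2k

    -- The neighbours of a vertex outside the cover W lie in W, and as |Z| < δ not all in Z:
    -- so the vertices of W of degree < D dominate all others, forcing n ≤ |W| (1 + D).
    |Z|≮δ : ¬ count Z < δ
    |Z|≮δ |Z|<δ = <⇒≱ 2k[D+1]<n (begin
        n
      ≡⟨ count-complement W ⟨
        count W + count (∁ W)
      ≤⟨ +-mono-≤ |W|≤2k (subst₂ _≤_ (trans (*-identityʳ _) (countᴸ-allFin (∁ W))) refl
           (union-bound low (adj G) (∁ W) (allFin n) low-small dominated)) ⟩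
        2 * k + count low * D
      ≤⟨ +-monoʳ-≤ (2 * k) (*-monoˡ-≤ D (≤-trans (count-mono {p = low} {q = W} λ w lw → ∧-conicalˡ _ _ lw)
                                                  |W|≤2k)) ⟩
        2 * k + 2 * k * D
      ≡⟨ *-suc (2 * k) D ⟨
        2 * k * suc D
      ∎)
      where
      open ≤-Reasoning
      low : Fin n → Bool
      low w = W w ∧ not (high w)
      low-small : ∀ w → low w ≡ true → countᴸ (adj G w) (allFin n) * 1 ≤ D
      low-small w lw = subst (_≤ D) (trans (sym (countᴸ-allFin (adj G w))) (sym (*-identityʳ _)))
        (<⇒≤ (≰⇒> λ D≤deg → subst T (not-injective (∧-conicalʳ (W w) _ lw)) (≤⇒≤ᵇ D≤deg)))
      dominated : ∀ u → ∁ W u ≡ true → ∃[ w ] low w ≡ true × adj G w u ≡ true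
      dominated u ∁Wu with find (λ w → adj G u w ∧ not (Z w))
      ... | inj₁ (w , e) = w , low-w , trans (Graph.sym G w u) (∧-conicalˡ _ _ e)
        where
        Ww : W w ≡ true
        Ww with cover u w (∧-conicalˡ _ _ e)
        ... | Wu∨Ww rewrite not-injective ∁Wu = Wu∨Ww
        low-w : low w ≡ true
        low-w with ∧-conicalʳ (adj G u w) _ e
        ... | ¬Zw rewrite Ww = ¬Zw
      ... | inj₂ none = contradiction (≤-<-trans (min-deg u) (≤-<-trans (count-mono nbrs⊆Z) |Z|<δ)) (<-irrefl refl)
        where
        nbrs⊆Z : adj G u ⇒ᵇ Z
        nbrs⊆Z w uw with Z w in Zw | none w
        ... | true  | _      = refl
        ... | false | uw∧Zw rewrite uw = contradiction uw∧Zw λ ()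

    private
      x = #ˢ (λ S → Indep S ∧ S ⊆ᵇ ∁ Z)
      y = #ˢ (λ S → Indep S ∧ not (S ⊆ᵇ ∁ Z))

    #indep≡x+y : #ˢ Indep ≡ x + y
    #indep≡x+y = #ˢ-split Indep (_⊆ᵇ ∁ Z)

    x≤2^|∁Z| : x ≤ 2 ^ count (∁ Z)
    x≤2^|∁Z| = ≤-trans (#ˢ-mono (λ S → ∧-conicalʳ (Indep S) _)) (≤-reflexive (#ˢ-⊆ᵇ (∁ Z)))

    y-small : ∀ a b → suc D ≡ a + b → count Z < 2 ^ b → y * 2 ^ a < 1 * 2 ^ n
    y-small a b D+1≡a+b |Z|<2^b = subst (y * 2 ^ a <_) (sym (*-identityˡ _))
      (drop-small-factor {y} n a b
        (subst (λ d → y * 2 ^ d ≤ count Z * 2 ^ n) D+1≡a+b (#indep-meeting G Z Z-high)) |Z|<2^b)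

    2^|∁Z|*2^|Z| : 2 ^ count (∁ Z) * 2 ^ count Z ≡ 2 ^ n
    2^|∁Z|*2^|Z| = trans (sym (^-distribˡ-+-* 2 (count (∁ Z)) _))
                         (cong (2 ^_) (trans (+-comm (count (∁ Z)) _) (count-complement Z)))

    many-high : δ < count Z → #ˢ Indep * 2 ^ δ < 2 ^ n
    many-high δ<|Z| = subst (λ m → m * 2 ^ δ < 2 ^ n) (sym #indep≡x+y) (split-below {x} {y} n δ 1 {1} {1} x-small
      (y-small (suc δ) (3 + δ) (suc-degreeBound≡[1+δ]+[3+δ] δ) (≤-<-trans |Z|≤2k (2k<2^[3+δ] δ))) refl)
      where
      x-small : x * 2 ^ (1 + δ) ≤ 1 * 2 ^ n
      x-small = begin
        x * 2 ^ (1 + δ)                ≤⟨ *-mono-≤ x≤2^|∁Z| (^-monoʳ-≤ 2 δ<|Z|) ⟩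
        2 ^ count (∁ Z) * 2 ^ count Z  ≡⟨ 2^|∁Z|*2^|Z| ⟩
        2 ^ n                          ≡⟨ *-identityˡ _ ⟨
        1 * 2 ^ n                      ∎
        where open ≤-Reasoning

    -- An edge uv outside Z: at most 3/4 of the subsets of the complement avoid containing both ends.
    edge-outside : count Z ≡ δ → ∀ {u v} → ∁ Z u ≡ true → ∁ Z v ≡ true → adj G u v ≡ true →
      #ˢ Indep * 2 ^ δ < 2 ^ n
    edge-outside |Z|≡δ {u} {v} ∁Zu ∁Zv edge = subst (λ m → m * 2 ^ δ < 2 ^ n) (sym #indep≡x+y)
      (split-below {x} {y} n δ 2 {3} {1} x-small
        (y-small (2 + δ) (2 + δ) (suc-degreeBound≡[2+δ]+[2+δ] δ)
                 (subst (_< 2 ^ (2 + δ)) (sym |Z|≡δ) (δ<2^[2+δ] δ))) refl)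
      where
      q = #ˢ (λ S → S ⊆ᵇ ∁ Z ∧ not (lookup S u ∧ lookup S v))
      x≤q : x ≤ q
      x≤q = #ˢ-mono λ S indep∧⊆ →
        cong₂ _∧_ (∧-conicalʳ (Indep S) _ indep∧⊆) (cong not (indep-∌-edge G S (∧-conicalˡ _ _ indep∧⊆) edge))
      4q≡3*2^|∁Z| : q * 4 ≡ 2 ^ count (∁ Z) * 3
      4q≡3*2^|∁Z| = trans
        (#ˢ-avoiding-pair (_⊆ᵇ ∁ Z) (edge⇒≢ G edge) (λ S → toggle-⊆ᵇ u S ∁Zu) (λ S → toggle-⊆ᵇ v S ∁Zv))
        (cong (_* 3) (#ˢ-⊆ᵇ (∁ Z)))
      x-small : x * 2 ^ (2 + δ) ≤ 3 * 2 ^ n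
      x-small = begin
          x * (2 * (2 * 2 ^ δ))
        ≡⟨ reorder x (2 ^ δ) ⟩
          x * 4 * 2 ^ δ
        ≤⟨ *-monoˡ-≤ (2 ^ δ) (*-monoˡ-≤ 4 x≤q) ⟩
          q * 4 * 2 ^ δ
        ≡⟨ cong (_* 2 ^ δ) 4q≡3*2^|∁Z| ⟩
          2 ^ count (∁ Z) * 3 * 2 ^ δ
        ≡⟨ reorder′ (2 ^ count (∁ Z)) (2 ^ δ) ⟩
          3 * (2 ^ count (∁ Z) * 2 ^ δ)
        ≡⟨ cong (λ d → 3 * (2 ^ count (∁ Z) * 2 ^ d)) (sym |Z|≡δ) ⟩
          3 * (2 ^ count (∁ Z) * 2 ^ count Z)
        ≡⟨ cong (3 *_) 2^|∁Z|*2^|Z| ⟩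
          3 * 2 ^ n
        ∎
        where
        open ≤-Reasoning
        reorder : ∀ x e → x * (2 * (2 * e)) ≡ x * 4 * e
        reorder = solve-∀
        reorder′ : ∀ c e → c * 3 * e ≡ 3 * (c * e)
        reorder′ = solve-∀

    joined : count Z ≡ δ → EdgeFree G (∁ Z) → FullyJoined G (∁ Z) Z
    joined |Z|≡δ ∁Z-free u v ∁Zu Zv =
      ⇒ᵇ-by-count nbrs⊆Z (subst (_≤ degree G u) (sym |Z|≡δ) (min-deg u)) v Zv
      where
      nbrs⊆Z : adj G u ⇒ᵇ Z
      nbrs⊆Z w uw with Z w in Zw
      ... | true  = refl
      ... | false = contradiction (trans (sym uw) (∁Z-free u w ∁Zu (cong not Zw))) λ ()

    ≤K-via-meeting : count Z ≡ δ → ∀ {m} →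
      #ˢ (λ S → Indep S ∧ not (S ⊆ᵇ ∁ Z)) + m ≤ #ˢ (λ S → S ⊆ᵇ Z ∧ not (S ⊆ᵇ ∁ Z)) →
      m + #ˢ Indep ≤ #ˢ KIndep
    ≤K-via-meeting |Z|≡δ meeting≤ = s≤s⁻¹ (begin
        suc (_ + #ˢ Indep)
      ≤⟨ #indep-via-meeting G Z meeting≤ ⟩
        2 ^ count (∁ Z) + 2 ^ count Z
      ≡⟨ cong₂ (λ a b → 2 ^ a + 2 ^ b) |∁Z|≡|∁side| |Z|≡δ ⟩
        2 ^ count (∁ (side {n} δ)) + 2 ^ δ
      ≤⟨ K-#indep-≥ δ≤n ⟩
        #ˢ KIndep + 1
      ≡⟨ +-comm _ 1 ⟩
        suc (#ˢ KIndep)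
      ∎)
      where
      open ≤-Reasoning
      |∁Z|≡|∁side| : count (∁ Z) ≡ count (∁ (side {n} δ))
      |∁Z|≡|∁side| = +-cancelˡ-≡ δ _ _
        (trans (cong (_+ count (∁ Z)) (sym |Z|≡δ)) (trans (count-complement Z) (sym (δ+|∁side|≡n δ≤n))))

    structured : count Z ≡ δ → EdgeFree G (∁ Z) → Outcome
    structured |Z|≡δ ∁Z-free with find₂ (λ u v → Z u ∧ Z v ∧ adj G u v)
    ... | inj₁ (h , h′ , e) = inj₁ (≤K-via-meeting |Z|≡δ
          (meeting-indep-< G Z joined′ (∧-conicalˡ _ _ e) (∧-conicalˡ _ _ (∧-conicalʳ (Z h) _ e))
                                       (∧-conicalʳ _ _ (∧-conicalʳ (Z h) _ e))))
      where joined′ = joined |Z|≡δ ∁Z-free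
    ... | inj₂ none = inj₂ (≤K-via-meeting |Z|≡δ (≤-trans (≤-reflexive (+-identityʳ _))
                                                  (#ˢ-mono (meeting-indep-⊆ᵇ G Z joined′))) ,
          ≅-from-colouring G (K n δ) Z (side δ) (adj≡xor G Z (no-edge⇒EdgeFree G none) ∁Z-free joined′)
            (λ _ _ → refl) (trans |Z|≡δ (sym (count-side δ δ≤n))))
      where joined′ = joined |Z|≡δ ∁Z-free

    outcome : Outcome
    outcome with <-cmp (count Z) δ
    ... | tri< |Z|<δ _ _ = contradiction |Z|<δ |Z|≮δ
    ... | tri> _ _ δ<|Z| = few⇒below-K (many-high δ<|Z|)
    ... | tri≈ _ |Z|≡δ _ with find₂ (λ u v → ∁ Z u ∧ ∁ Z v ∧ adj G u v)
    ...   | inj₁ (u , v , e) = few⇒below-K (edge-outside |Z|≡δ (∧-conicalˡ _ _ e)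
            (∧-conicalˡ _ _ (∧-conicalʳ (∁ Z u) _ e)) (∧-conicalʳ _ _ (∧-conicalʳ (∁ Z u) _ e)))
    ...   | inj₂ none = structured |Z|≡δ (no-edge⇒EdgeFree G none)

  extremal : Outcome
  extremal with matching-or-cover G k
  ... | inj₁ (es , |es|≡k , matching) = few⇒below-K (few-indep-matching es |es|≡k matching)
  ... | inj₂ (W , |W|≤2k , cover)     = outcome W |W|≤2k cover

outcome⇒extremal : ∀ {n δ} (G : Graph n) →
  #ˢ (isIndependent G) < #ˢ (isIndependent (K n δ)) ⊎
    (#ˢ (isIndependent G) ≤ #ˢ (isIndependent (K n δ)) × G ≅ K n δ) →
  (numIndep G ≤ numIndep (K n δ)) × (numIndep G ≡ numIndep (K n δ) → G ≅ K n δ)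
outcome⇒extremal {n} {δ} G outcome rewrite numIndep≡#ˢ G | numIndep≡#ˢ (K n δ) with outcome
... | inj₁ fewer       = <⇒≤ fewer , λ same → contradiction same (<⇒≢ fewer)
... | inj₂ (≤K , G≅K) = ≤K , λ _ → G≅K

corollary1p6 : (δ : ℕ) → 1 ≤ δ →
    Σ ℕ λ n₀ → (n : ℕ) → n₀ ≤ n →
      MinDegreeAtLeast δ (K n δ) ×
      ((G : Graph n) → MinDegreeAtLeast δ G →
        (numIndep G ≤ numIndep (K n δ)) ×
        (numIndep G ≡ numIndep (K n δ) → G ≅ K n δ))
-- The argument never uses δ ≥ 1.
corollary1p6 δ _ = n₀ δ , λ n large →
  K-minDegree (n₀⇒δ≤n {δ} large) (n₀⇒2δ≤n {δ} large) ,
  λ G min-deg → outcome⇒extremal {δ = δ} G (Extremal.extremal large G min-deg)
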